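{- Let $\mathcal{F}$ be a CNF formula, let $\mathcal{R}=\mathcal{F}$, and for $\mathcal{W}\subseteq\mathcal{R}$ let $P(\mathcal{W})=\mathrm{SAT}\big(\neg\mathcal{F}\wedge\bigwedge_{c\in\mathcal{R}\setminus\mathcal{W}}c\big)$. Then $P$ is monotone, and every minimal subset $\mathcal{D}\subseteq\mathcal{R}$ for $P$ is a Minimal Distinguishing Subset of $\mathcal{F}$. (Hence computing an MDS reduces to the MSMP problem.)
   Context: A CNF formula is a set of clauses. $\mathrm{SAT}(\varphi)$ is $1$ iff $\varphi$ is satisfiable. A predicate $P:2^{\mathcal{R}}\to\{0,1\}$ is monotone if $P(\mathcal{R}_0)$ and $\mathcal{R}_0\subseteq\mathcal{R}_1\subseteq\mathcal{R}$ imply $P(\mathcal{R}_1)$; $\mathcal{M}\subseteq\mathcal{R}$ is minimal for $P$ if $P(\mathcal{M})$ holds and $P(\mathcal{M}')$ fails for every $\mathcal{M}'\subsetneq\mathcal{M}$. The MSMP problem asks for a minimal set for a given monotone predicate. $\mathcal{D}\subseteq\mathcal{F}$ is a Minimal Distinguishing Subset (MDS) of $\mathcal{F}$ iff $\mathcal{F}\setminus\mathcal{D}\not\equiv\mathcal{F}$ and $\mathcal{F}\setminus\mathcal{D}'\equiv\mathcal{F}$ for all $\mathcal{D}'\subsetneq\mathcal{D}$. -}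

module Defs where

open import Data.Bool using (Bool; true; false; _∧_; _∨_; not)
open import Data.Bool.Base using (if_then_else_)
open import Data.Nat using (ℕ)
open import Data.Fin using (Fin)
open import Data.Fin.Subset using (Subset; _∈_; _⊆_; _⊂_; ∁; ⊤)
open import Data.List using (List)
open import Data.Bool.ListAction using (any)
open import Data.Vec using (Vec; lookup)
open import Data.Product using (Σ; _×_)
open import Relation.Nullary using (¬_)
open import Relation.Binary.PropositionalEquality using (_≡_)

Assignment : Set
Assignment = ℕ → Bool

record Literal : Set where
  constructor lit
  field
    polarity : Bool
    var      : ℕ

evalLit : Assignment → Literal → Bool
evalLit α (lit true  x) = α x
evalLit α (lit false x) = not (α x)

Clause : Set
Clause = List Literal

evalClause : Assignment → Clause → Bool
evalClause α c = any (evalLit α) c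

CNF : ℕ → Set
CNF m = Vec Clause m

Models : ∀ {m} → CNF m → Subset m → Assignment → Set
Models F S α = ∀ i → i ∈ S → evalClause α (lookup F i) ≡ true

Equiv : ∀ {m} → CNF m → Subset m → Subset m → Set
Equiv F S T = ∀ α → (Models F S α → Models F T α) × (Models F T α → Models F S α)

Pred : ℕ → Set₁
Pred m = Subset m → Set

Monotone : ∀ {m} → Pred m → Set
Monotone {m} P = ∀ (R₀ R₁ : Subset m) → P R₀ → R₀ ⊆ R₁ → P R₁

Minimal : ∀ {m} → Pred m → Subset m → Set
Minimal {m} P M = P M × (∀ (M' : Subset m) → M' ⊂ M → ¬ P M')

MDS : ∀ {m} → CNF m → Subset m → Set
MDS {m} F D = ¬ Equiv F (∁ D) ⊤ × (∀ (D' : Subset m) → D' ⊂ D → Equiv F (∁ D') ⊤)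

Pmds : ∀ {m} → CNF m → Pred m
Pmds F W = Σ Assignment (λ α → ¬ Models F ⊤ α × Models F (∁ W) α)

-- A sub-formula of F is equivalent to F exactly when it entails F, so P(W) says precisely
-- that F \ W is not equivalent to F; minimality for P is then the definition of an MDS
-- read literally. Monotonicity holds because enlarging W removes clauses to be satisfied.
module Submission where

open import Defs
open import Data.Nat using (ℕ)
open import Data.Bool using (true)
open import Data.Bool.Properties using (_≟_)
open import Data.Fin.Subset using (Subset; _⊆_; ∁; ⊤)
open import Data.Fin.Subset.Properties using (⊆⊤; p⊆q⇒∁p⊇∁q)
open import Data.Vec using (lookup)
open import Data.Product using (_×_; _,_)
open import Relation.Nullary using (¬_)
open import Relation.Nullary.Negation using (Stable)
open import Relation.Nullary.Decidable using (decidable-stable)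

module _ {m : ℕ} (F : CNF m) where

  Models-antitone : ∀ {S T : Subset m} {α : Assignment} →
                    S ⊆ T → Models F T α → Models F S α
  Models-antitone S⊆T M i i∈S = M i (S⊆T i∈S)

  -- Clause evaluation is Boolean, so being a model is decidable clause by clause.
  Models-stable : ∀ (S : Subset m) (α : Assignment) → Stable (Models F S α)
  Models-stable S α ¬¬M i i∈S =
    decidable-stable (evalClause α (lookup F i) ≟ true) λ ¬holds →
      ¬¬M λ M → ¬holds (M i i∈S)

  entails⇒Equiv-⊤ : ∀ {S : Subset m} →
                    (∀ α → Models F S α → Models F ⊤ α) → Equiv F S ⊤
  entails⇒Equiv-⊤ S⊨F α = S⊨F α , Models-antitone ⊆⊤

  Pmds-monotone : Monotone (Pmds F)
  Pmds-monotone R₀ R₁ (α , ¬F , M) R₀⊆R₁ = α , ¬F , Models-antitone (p⊆q⇒∁p⊇∁q R₀⊆R₁) M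

  Pmds⇒¬Equiv : ∀ {W : Subset m} → Pmds F W → ¬ Equiv F (∁ W) ⊤
  Pmds⇒¬Equiv (α , ¬F , M) equiv with equiv α
  ... | ∁W⇒F , _ = ¬F (∁W⇒F M)

  ¬Pmds⇒Equiv : ∀ {W : Subset m} → ¬ Pmds F W → Equiv F (∁ W) ⊤
  ¬Pmds⇒Equiv ¬P = entails⇒Equiv-⊤ λ α M →
    Models-stable ⊤ α λ ¬F → ¬P (α , ¬F , M)

proposition11 : ∀ {m : ℕ} (F : CNF m) →
    Monotone (Pmds F) × (∀ (D : Subset m) → Minimal (Pmds F) D → MDS F D)
proposition11 F = Pmds-monotone F , minimal⇒MDS
  where
  minimal⇒MDS : ∀ D → Minimal (Pmds F) D → MDS F D
  minimal⇒MDS D (PD , below-D-fails) =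
    Pmds⇒¬Equiv F PD , λ D' D'⊂D → ¬Pmds⇒Equiv F (below-D-fails D' D'⊂D)
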